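{- Let $n$, $r$, $a$ be positive integers with $n=2r+1$ and $a\ge 2$. Then $\rho_2(n+2a,r+a)\ge 2^{\lfloor a/2\rfloor}\rho_2(n,r)$.
   Context: For integers $n\ge 2r\ge 2$, the Kneser graph $K(n,r)$ has as vertices the $r$-element subsets of $[n]=\{1,\dots,n\}$, two vertices being adjacent iff they are disjoint. A 2-packing of a graph is a set of vertices that are pairwise at distance at least $3$ (no two adjacent and no two with a common neighbor); $\rho_2(G)$ is the maximum cardinality of a 2-packing, and $\rho_2(n,r)=\rho_2(K(n,r))$. -}

module Defs where

open import Data.Nat using (ℕ; _≤_)
open import Data.Fin.Subset using (Subset; _∩_; Empty; ∣_∣)
open import Data.List using (List; length)
open import Data.List.Relation.Unary.All using (All)
open import Data.List.Relation.Unary.AllPairs using (AllPairs)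
open import Data.Product using (Σ; _×_; ∃)
open import Relation.Binary.PropositionalEquality using (_≡_; _≢_)
open import Relation.Nullary using (¬_)

-- Kneser graph K(n,r): vertices are r-element subsets of [n] (Fin n),
-- adjacency is disjointness.
KVertex : (n r : ℕ) → Subset n → Set
KVertex n r s = ∣ s ∣ ≡ r

KAdj : {n : ℕ} → Subset n → Subset n → Set
KAdj u v = Empty (u ∩ v)

-- u and v are at distance at least 3 in K(n,r):
-- distinct, not adjacent, and without a common neighbour.
FarApart : (n r : ℕ) → Subset n → Subset n → Set
FarApart n r u v =
  u ≢ v × ¬ KAdj u v × ¬ (∃ λ w → KVertex n r w × KAdj u w × KAdj w v)

-- A 2-packing of K(n,r), given as a list of vertices that are
-- pairwise at distance ≥ 3 (in particular pairwise distinct).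
Is2Packing : (n r : ℕ) → List (Subset n) → Set
Is2Packing n r P = All (KVertex n r) P × AllPairs (FarApart n r) P

IsRho2 : (n r k : ℕ) → Set
IsRho2 n r k =
  (Σ (List (Subset n)) λ P → Is2Packing n r P × length P ≡ k)
  × (∀ P → Is2Packing n r P → length P ≤ k)

-- Two vertices u, v of the Kneser graph K(N,R) have a common neighbour iff
-- ∁ (u ∪ v) has at least R elements, so they are at distance ≥ 3 iff they are
-- distinct, intersecting and N < R + |u ∪ v|.  Extend every vertex u of a
-- 2-packing of K(2r+1,r) by every member x of a family of a-subsets of [2a]
-- whose pairwise unions have at least a + 2 elements.  For u ≠ v the distance
-- condition survives because |x ∪ y| ≥ a; for u = v the bound |x ∪ y| ≥ a + 2
-- alone separates u ++ x from u ++ y.  Products of such families are again such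
-- families, and ⌊a/2⌋ copies of {1100, 0011}, with {10} when a is odd, give
-- one of size 2^⌊a/2⌋.
module Submission where

open import Defs
open import Data.Fin using (Fin; _↑ˡ_)
open import Data.Fin.Subset
  using (Subset; inside; outside; _∩_; _∪_; ∁; ⊥; ∣_∣; Empty; _∈_; _⊆_)
open import Data.Fin.Subset.Properties
  using ( Empty-unique; ∣⊥∣≡0; ∣p∣≤n; ⊥⊆; in⊆in; out⊆; p⊆q⇒∣p∣≤∣q∣; ∣∁p∣≡n∸∣p∣
        ; x∈∁p⇒x∉p; x∉p⇒x∈∁p; x∈p∩q⁺; x∈p∩q⁻; x∈p∪q⁻; p⊆p∪q; q⊆p∪q
        ; ∣p∣≤∣p∪q∣; ∪-idem; ∩-idem )
open import Data.List using (List; []; _∷_; length; map; cartesianProductWith)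
open import Data.List.Properties using (length-++; length-map)
open import Data.List.Relation.Unary.All as All using (All; []; _∷_)
import Data.List.Relation.Unary.All.Properties as All
open import Data.List.Relation.Unary.AllPairs as AllPairs using (AllPairs; []; _∷_)
import Data.List.Relation.Unary.AllPairs.Properties as AllPairs
open import Data.Nat using (ℕ; zero; suc; _+_; _*_; _^_; _∸_; _≤_; _<_; z≤n; s≤s)
open import Data.Nat.DivMod using (_/_; m/n≡1+[m∸n]/n)
open import Data.Nat.Properties
open import Algebra.Properties.CommutativeSemigroup +-commutativeSemigroup
  using (interchange; xy∙z≈xz∙y)
open import Data.Nat.Tactic.RingSolver using (solve-∀)
open import Data.Product using (Σ-syntax; ∃; _×_; _,_)
open import Data.Sum using (inj₁; inj₂)
open import Data.Vec using (_∷_; _++_; []; here; there)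
open import Data.Vec.Properties using (zipWith-++; ++-injectiveˡ; ++-injectiveʳ)
open import Level using (Level)
open import Relation.Binary.Core using (Rel)
open import Relation.Binary.PropositionalEquality
open import Relation.Nullary using (¬_)
open import Relation.Unary using (Pred)

private
  variable
    a ℓ : Level
    X Y Z : Set a
    m n N R L A L′ A′ : ℕ
    s t u v w x y : Subset m

length-cartesianProductWith : (f : X → Y → Z) (xs : List X) (ys : List Y) →
  length (cartesianProductWith f xs ys) ≡ length xs * length ys
length-cartesianProductWith f []       ys = refl
length-cartesianProductWith f (x ∷ xs) ys =
  trans (length-++ (map (f x) ys))
        (cong₂ _+_ (length-map (f x) ys) (length-cartesianProductWith f xs ys))

All-cartesianProductWith⁺ : {P : Pred X ℓ} {Q : Pred Y ℓ} {T : Pred Z ℓ}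
  (f : X → Y → Z) → (∀ x y → P x → Q y → T (f x y)) →
  ∀ {xs ys} → All P xs → All Q ys → All T (cartesianProductWith f xs ys)
All-cartesianProductWith⁺ f pres []         qys = []
All-cartesianProductWith⁺ f pres (px ∷ pxs) qys =
  All.++⁺ (All.map⁺ (All.map (pres _ _ px) qys)) (All-cartesianProductWith⁺ f pres pxs qys)

AllPairs-cartesianProductWith⁺ :
  {S : Rel X ℓ} {T : Rel Y ℓ} {_∼_ : Rel Z ℓ} {V : Pred X ℓ} {W : Pred Y ℓ}
  (f : X → Y → Z) →
  (across : ∀ u v x y → S u v → W x → f u x ∼ f v y) →
  (along : ∀ u x y → V u → W x → T x y → f u x ∼ f u y) →
  ∀ {us xs} → All V us → AllPairs S us → All W xs → AllPairs T xs →
  AllPairs _∼_ (cartesianProductWith f us xs)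
AllPairs-cartesianProductWith⁺ {S = S} {T = T} {_∼_ = _∼_} {V = V} {W = W} f across along = go
  where
  withLeft : ∀ {xs} → All W xs → AllPairs T xs → AllPairs (λ x y → W x × T x y) xs
  withLeft []         []         = []
  withLeft (wx ∷ wxs) (tx ∷ txs) = All.map (wx ,_) tx ∷ withLeft wxs txs

  go : ∀ {us xs} → All V us → AllPairs S us → All W xs → AllPairs T xs →
       AllPairs _∼_ (cartesianProductWith f us xs)
  go []         []         wxs txs = []
  go (vu ∷ vus) (su ∷ sus) wxs txs =
    AllPairs.++⁺
      (AllPairs.map⁺ (AllPairs.map (λ (wx , txy) → along _ _ _ vu wx txy) (withLeft wxs txs)))
      (go vus sus wxs txs)
      (All.map⁺ (All.map (λ wx → All-cartesianProductWith⁺ f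
                                    (λ _ _ suv _ → across _ _ _ _ suv wx) su wxs)
                          wxs))

∈-++⁺ˡ : {p : Subset m} {q : Subset n} {i : Fin m} → i ∈ p → i ↑ˡ n ∈ p ++ q
∈-++⁺ˡ here        = here
∈-++⁺ˡ (there i∈p) = there (∈-++⁺ˡ i∈p)

Empty-++⁻ˡ : (p : Subset m) {q : Subset n} → Empty (p ++ q) → Empty p
Empty-++⁻ˡ p empty (i , i∈p) = empty (i ↑ˡ _ , ∈-++⁺ˡ i∈p)

∣p++q∣≡∣p∣+∣q∣ : (p : Subset m) (q : Subset n) → ∣ p ++ q ∣ ≡ ∣ p ∣ + ∣ q ∣
∣p++q∣≡∣p∣+∣q∣ []            q = refl
∣p++q∣≡∣p∣+∣q∣ (inside ∷ p)  q = cong suc (∣p++q∣≡∣p∣+∣q∣ p q)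
∣p++q∣≡∣p∣+∣q∣ (outside ∷ p) q = ∣p++q∣≡∣p∣+∣q∣ p q

∩-++ : (p p′ : Subset m) (q q′ : Subset n) → (p ++ q) ∩ (p′ ++ q′) ≡ (p ∩ p′) ++ (q ∩ q′)
∩-++ p p′ q q′ = zipWith-++ _ p q p′ q′

∣∪-++∣ : (p p′ : Subset m) (q q′ : Subset n) →
  ∣ (p ++ q) ∪ (p′ ++ q′) ∣ ≡ ∣ p ∪ p′ ∣ + ∣ q ∪ q′ ∣
∣∪-++∣ p p′ q q′ = trans (cong ∣_∣ (zipWith-++ _ p q p′ q′)) (∣p++q∣≡∣p∣+∣q∣ (p ∪ p′) (q ∪ q′))

⊆-ofSize : ∀ k (p : Subset n) → k ≤ ∣ p ∣ → ∃ λ q → q ⊆ p × ∣ q ∣ ≡ k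
⊆-ofSize {n} zero p _ = ⊥ , ⊥⊆ , ∣⊥∣≡0 n
⊆-ofSize (suc k) (inside ∷ p)  (s≤s k≤∣p∣) with ⊆-ofSize k p k≤∣p∣
... | q , q⊆p , ∣q∣≡k = inside ∷ q , in⊆in q⊆p , cong suc ∣q∣≡k
⊆-ofSize (suc k) (outside ∷ p) k<∣p∣ with ⊆-ofSize (suc k) p k<∣p∣
... | q , q⊆p , ∣q∣≡k = outside ∷ q , out⊆ q⊆p , ∣q∣≡k

KVertex-++ : (u : Subset m) (x : Subset n) →
  KVertex m R u → KVertex n A x → KVertex (m + n) (R + A) (u ++ x)
KVertex-++ u x ∣u∣≡R ∣x∣≡A = trans (∣p++q∣≡∣p∣+∣q∣ u x) (cong₂ _+_ ∣u∣≡R ∣x∣≡A)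

¬KAdj-++ : {u v : Subset m} {x y : Subset n} → ¬ KAdj u v → ¬ KAdj (u ++ x) (v ++ y)
¬KAdj-++ {u = u} {v = v} {x = x} {y = y} ¬u#v u#v = ¬u#v (Empty-++⁻ˡ (u ∩ v) (subst Empty (∩-++ u v x y) u#v))

CommonNeighbour : (m R : ℕ) → Subset m → Subset m → Set
CommonNeighbour m R s t = ∃ λ w → KVertex m R w × KAdj s w × KAdj w t

KAdj-both⇒⊆∁∪ : KAdj s w → KAdj w t → w ⊆ ∁ (s ∪ t)
KAdj-both⇒⊆∁∪ {s = s} {w = w} {t = t} s#w w#t {i} i∈w = x∉p⇒x∈∁p i∉s∪t
  where
  i∉s∪t : ¬ i ∈ s ∪ t
  i∉s∪t i∈s∪t with x∈p∪q⁻ s t i∈s∪t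
  ... | inj₁ i∈s = s#w (i , x∈p∩q⁺ (i∈s , i∈w))
  ... | inj₂ i∈t = w#t (i , x∈p∩q⁺ (i∈w , i∈t))

⊆∁∪⇒KAdj-both : w ⊆ ∁ (s ∪ t) → KAdj s w × KAdj w t
⊆∁∪⇒KAdj-both {w = w} {s = s} {t = t} w⊆∁s∪t = s#w , w#t
  where
  s#w : KAdj s w
  s#w (i , i∈s∩w) with x∈p∩q⁻ s w i∈s∩w
  ... | i∈s , i∈w = x∈∁p⇒x∉p (w⊆∁s∪t i∈w) (p⊆p∪q t i∈s)
  w#t : KAdj w t
  w#t (i , i∈w∩t) with x∈p∩q⁻ w t i∈w∩t
  ... | i∈w , i∈t = x∈∁p⇒x∉p (w⊆∁s∪t i∈w) (q⊆p∪q s t i∈t)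

CommonNeighbour⇒ : CommonNeighbour m R s t → R + ∣ s ∪ t ∣ ≤ m
CommonNeighbour⇒ {m = m} {R = R} {s = s} {t = t} (w , ∣w∣≡R , s#w , w#t) =
  m≤o∸n⇒m+n≤o R (∣p∣≤n (s ∪ t)) (begin
    R                  ≡⟨ sym ∣w∣≡R ⟩
    ∣ w ∣              ≤⟨ p⊆q⇒∣p∣≤∣q∣ (KAdj-both⇒⊆∁∪ s#w w#t) ⟩
    ∣ ∁ (s ∪ t) ∣      ≡⟨ ∣∁p∣≡n∸∣p∣ (s ∪ t) ⟩
    m ∸ ∣ s ∪ t ∣      ∎)
  where open ≤-Reasoning

CommonNeighbour⇐ : R + ∣ s ∪ t ∣ ≤ m → CommonNeighbour m R s t
CommonNeighbour⇐ {R = R} {s = s} {t = t} R+∣s∪t∣≤m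
  with ⊆-ofSize R (∁ (s ∪ t))
         (subst (R ≤_) (sym (∣∁p∣≡n∸∣p∣ (s ∪ t))) (m+n≤o⇒m≤o∸n R R+∣s∪t∣≤m))
... | w , w⊆∁s∪t , ∣w∣≡R = w , ∣w∣≡R , ⊆∁∪⇒KAdj-both w⊆∁s∪t

FarApart⇒ : FarApart N R u v → N < R + ∣ u ∪ v ∣
FarApart⇒ (_ , _ , noCommonNeighbour) = ≰⇒> (λ le → noCommonNeighbour (CommonNeighbour⇐ le))

FarApart⇐ : u ≢ v → ¬ KAdj u v → N < R + ∣ u ∪ v ∣ → FarApart N R u v
FarApart⇐ u≢v ¬u#v N<R+∣u∪v∣ = u≢v , ¬u#v , λ common → <⇒≱ N<R+∣u∪v∣ (CommonNeighbour⇒ common)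

FarApart-++-across : L ≤ 2 * A → (u v : Subset N) (x y : Subset L) →
  FarApart N R u v → KVertex L A x → FarApart (N + L) (R + A) (u ++ x) (v ++ y)
FarApart-++-across {L = L} {A = A} {N = N} {R = R} L≤2A u v x y far@(u≢v , ¬u#v , _) ∣x∣≡A =
  FarApart⇐ (λ eq → u≢v (++-injectiveˡ u v eq)) (¬KAdj-++ ¬u#v) (begin-strict
    N + L                               <⟨ +-mono-<-≤ (FarApart⇒ far) L≤A+∣x∪y∣ ⟩
    (R + ∣ u ∪ v ∣) + (A + ∣ x ∪ y ∣)   ≡⟨ interchange R _ A _ ⟩
    (R + A) + (∣ u ∪ v ∣ + ∣ x ∪ y ∣)   ≡⟨ cong (R + A +_) (∣∪-++∣ u v x y) ⟨
    (R + A) + ∣ (u ++ x) ∪ (v ++ y) ∣   ∎)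
  where
  open ≤-Reasoning
  L≤A+∣x∪y∣ : L ≤ A + ∣ x ∪ y ∣
  L≤A+∣x∪y∣ = begin
    L              ≤⟨ L≤2A ⟩
    A + (A + 0)    ≡⟨ cong (A +_) (trans (+-identityʳ A) (sym ∣x∣≡A)) ⟩
    A + ∣ x ∣      ≤⟨ +-monoʳ-≤ A (∣p∣≤∣p∪q∣ x y) ⟩
    A + ∣ x ∪ y ∣  ∎

FarApart-++-along : 1 ≤ R → N ≤ 2 * R + 1 → L ≤ 2 * A → (u : Subset N) (x y : Subset L) →
  KVertex N R u → KVertex L A x → A + 2 ≤ ∣ x ∪ y ∣ → FarApart (N + L) (R + A) (u ++ x) (u ++ y)
FarApart-++-along {R = R} {N = N} {L = L} {A = A} 1≤R N≤2R+1 L≤2A u x y ∣u∣≡R ∣x∣≡A A+2≤∣x∪y∣ =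
  FarApart⇐ (λ eq → x≢y (++-injectiveʳ u u eq)) (¬KAdj-++ ¬u#u) (begin-strict
    N + L                                <⟨ s≤s (+-mono-≤ N≤2R+1 L≤2A) ⟩
    suc ((2 * R + 1) + 2 * A)            ≡⟨ rearrange R A ⟩
    (R + A) + (R + (A + 2))              ≤⟨ +-monoʳ-≤ (R + A) (+-mono-≤ (≤-reflexive (sym ∣u∪u∣≡R))
                                                                  A+2≤∣x∪y∣) ⟩
    (R + A) + (∣ u ∪ u ∣ + ∣ x ∪ y ∣)    ≡⟨ cong (R + A +_) (∣∪-++∣ u u x y) ⟨
    (R + A) + ∣ (u ++ x) ∪ (u ++ y) ∣    ∎)
  where
  open ≤-Reasoning
  rearrange : ∀ R A → suc ((2 * R + 1) + 2 * A) ≡ (R + A) + (R + (A + 2))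
  rearrange = solve-∀
  ∣u∪u∣≡R : ∣ u ∪ u ∣ ≡ R
  ∣u∪u∣≡R = trans (cong ∣_∣ (∪-idem u)) ∣u∣≡R
  x≢y : x ≢ y
  x≢y refl = m+1+n≰m A (subst (A + 2 ≤_) (trans (cong ∣_∣ (∪-idem x)) ∣x∣≡A) A+2≤∣x∪y∣)
  ¬u#u : ¬ KAdj u u
  ¬u#u u#u = <-irrefl (sym ∣u∣≡0) (subst (0 <_) (sym ∣u∣≡R) 1≤R)
    where
    ∣u∣≡0 : ∣ u ∣ ≡ 0
    ∣u∣≡0 = trans (cong ∣_∣ (Empty-unique (subst Empty (∩-idem u) u#u))) (∣⊥∣≡0 N)

Spread : (L A : ℕ) → List (Subset L) → Set
Spread L A E = All (KVertex L A) E × AllPairs (λ x y → A + 2 ≤ ∣ x ∪ y ∣) E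

Is2Packing-extend : {P : List (Subset N)} {E : List (Subset L)} →
  1 ≤ R → N ≤ 2 * R + 1 → L ≤ 2 * A → Is2Packing N R P → Spread L A E →
  Is2Packing (N + L) (R + A) (cartesianProductWith _++_ P E)
Is2Packing-extend 1≤R N≤2R+1 L≤2A (P-vertices , P-far) (E-vertices , E-spread) =
  All-cartesianProductWith⁺ _++_ KVertex-++ P-vertices E-vertices ,
  AllPairs-cartesianProductWith⁺ _++_
    (FarApart-++-across L≤2A) (FarApart-++-along 1≤R N≤2R+1 L≤2A)
    P-vertices P-far E-vertices E-spread

Spread-++ : {E : List (Subset L)} {F : List (Subset L′)} →
  Spread L A E → Spread L′ A′ F → Spread (L + L′) (A + A′) (cartesianProductWith _++_ E F)
Spread-++ {A = A} {A′ = A′} (E-vertices , E-spread) (F-vertices , F-spread) =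
  All-cartesianProductWith⁺ _++_ KVertex-++ E-vertices F-vertices ,
  AllPairs-cartesianProductWith⁺ _++_ across along E-vertices E-spread F-vertices F-spread
  where
  open ≤-Reasoning
  across : ∀ (x y : Subset _) (x′ y′ : Subset _) → A + 2 ≤ ∣ x ∪ y ∣ → KVertex _ A′ x′ →
    A + A′ + 2 ≤ ∣ (x ++ x′) ∪ (y ++ y′) ∣
  across x y x′ y′ A+2≤∣x∪y∣ ∣x′∣≡A′ = begin
    A + A′ + 2               ≡⟨ xy∙z≈xz∙y A A′ 2 ⟩
    (A + 2) + A′             ≡⟨ cong (A + 2 +_) ∣x′∣≡A′ ⟨
    (A + 2) + ∣ x′ ∣         ≤⟨ +-mono-≤ A+2≤∣x∪y∣ (∣p∣≤∣p∪q∣ x′ y′) ⟩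
    ∣ x ∪ y ∣ + ∣ x′ ∪ y′ ∣  ≡⟨ ∣∪-++∣ x y x′ y′ ⟨
    ∣ (x ++ x′) ∪ (y ++ y′) ∣ ∎
  along : ∀ (x : Subset _) (x′ y′ : Subset _) → KVertex _ A x → KVertex _ A′ x′ →
    A′ + 2 ≤ ∣ x′ ∪ y′ ∣ → A + A′ + 2 ≤ ∣ (x ++ x′) ∪ (x ++ y′) ∣
  along x x′ y′ ∣x∣≡A _ A′+2≤∣x′∪y′∣ = begin
    A + A′ + 2               ≡⟨ +-assoc A A′ 2 ⟩
    A + (A′ + 2)             ≡⟨ cong (_+ (A′ + 2)) (trans (sym ∣x∣≡A) (cong ∣_∣ (sym (∪-idem x)))) ⟩
    ∣ x ∪ x ∣ + (A′ + 2)      ≤⟨ +-monoʳ-≤ ∣ x ∪ x ∣ A′+2≤∣x′∪y′∣ ⟩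
    ∣ x ∪ x ∣ + ∣ x′ ∪ y′ ∣  ≡⟨ ∣∪-++∣ x x x′ y′ ⟨
    ∣ (x ++ x′) ∪ (x ++ y′) ∣ ∎

SpreadFamily : (L A e : ℕ) → Set
SpreadFamily L A e = Σ[ E ∈ List (Subset L) ] Spread L A E × length E ≡ e

spreadFamily : ∀ a → SpreadFamily (2 * a) a (2 ^ (a / 2))
spreadFamily 0             = [] ∷ [] , (refl ∷ [] , [] ∷ []) , refl
spreadFamily 1             = (inside ∷ outside ∷ []) ∷ [] , (refl ∷ [] , [] ∷ []) , refl
spreadFamily (suc (suc a)) with spreadFamily a
... | E , E-spread , |E|≡2^[a/2] =
  subst₂ (λ L e → SpreadFamily L (2 + a) e)
    (sym (*-distribˡ-+ 2 2 a))
    (cong (2 ^_) (sym (m/n≡1+[m∸n]/n {2 + a} {2} (s≤s (s≤s z≤n)))))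
    ( cartesianProductWith _++_ halves E
    , Spread-++ halves-spread E-spread
    , trans (length-cartesianProductWith _++_ halves E) (cong (2 *_) |E|≡2^[a/2]) )
  where
  halves : List (Subset 4)
  halves = (inside ∷ inside ∷ outside ∷ outside ∷ [])
         ∷ (outside ∷ outside ∷ inside ∷ inside ∷ [])
         ∷ []
  halves-spread : Spread 4 2 halves
  halves-spread = refl ∷ refl ∷ [] , (≤-refl ∷ []) ∷ [] ∷ []

mainTheorem10 : (n r a : ℕ) → 1 ≤ r → n ≡ 2 * r + 1 → 2 ≤ a →
    (k k′ : ℕ) → IsRho2 n r k → IsRho2 (n + 2 * a) (r + a) k′ →
    2 ^ (a / 2) * k ≤ k′
mainTheorem10 n r a 1≤r n≡2r+1 _ k k′ ((P , P-packing , refl) , _) (_ , maximal)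
  with spreadFamily a
... | E , E-spread , |E|≡2^[a/2] = begin
  2 ^ (a / 2) * length P                       ≡⟨ *-comm (2 ^ (a / 2)) (length P) ⟩
  length P * 2 ^ (a / 2)                       ≡⟨ cong (length P *_) |E|≡2^[a/2] ⟨
  length P * length E                          ≡⟨ length-cartesianProductWith _++_ P E ⟨
  length (cartesianProductWith _++_ P E)       ≤⟨ maximal _ extended-packing ⟩
  k′                                           ∎
  where
  open ≤-Reasoning
  extended-packing : Is2Packing (n + 2 * a) (r + a) (cartesianProductWith _++_ P E)
  extended-packing = Is2Packing-extend 1≤r (≤-reflexive n≡2r+1) ≤-refl P-packing E-spread
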